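{- Let $n\equiv 1,3\pmod 6$ with $n\geq 13$, and let $\mathcal{S}$ be a Steiner triple system of order $n$ on $[n]$. Then the blocks of $\mathcal{S}$ form a resolving set for the Kneser graph $K(n,3)$. Consequently $\beta(K(n,3))\leq n(n-1)/6$.
   Context: A Steiner triple system of order $n$ is a family of $3$-subsets (blocks) of $[n]=\{1,\dots,n\}$ such that every pair of distinct elements lies in exactly one block. The Kneser graph $K(n,3)$ has as vertices the $3$-subsets of $[n]$, adjacent when disjoint. A resolving set is a set $\mathcal{S}$ of vertices such that for all distinct vertices $U,W$ some $X\in\mathcal{S}$ has $d(U,X)\neq d(W,X)$; $\beta$ is the minimum size of a resolving set. -}

module Defs where

open import Data.Nat using (ℕ; zero; suc; _≤_)
open import Data.Fin using (Fin)
open import Data.Fin.Subset using (Subset; _∈_; _∩_; ⊥; ∣_∣)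
open import Data.Product using (Σ; ∃; _×_; _,_; proj₁)
open import Data.List using (List; length)
open import Data.List.Membership.Propositional renaming (_∈_ to _∈ₗ_)
open import Data.List.Relation.Unary.Unique.Propositional using (Unique)
open import Relation.Binary.PropositionalEquality using (_≡_; _≢_)

Vertex : ℕ → Set
Vertex n = Σ (Subset n) (λ s → ∣ s ∣ ≡ 3)

Adj : ∀ {n} → Vertex n → Vertex n → Set
Adj U W = (proj₁ U ∩ proj₁ W) ≡ ⊥

data Walk {n : ℕ} : Vertex n → Vertex n → ℕ → Set where
  here : ∀ {U} → Walk U U zero
  step : ∀ {U V W k} → Adj U V → Walk V W k → Walk U W (suc k)

Dist : ∀ {n} → Vertex n → Vertex n → ℕ → Set
Dist U W k = Walk U W k × (∀ m → Walk U W m → k ≤ m)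

IsResolving : ∀ {n} → List (Vertex n) → Set
IsResolving {n} S =
  ∀ (U W : Vertex n) → proj₁ U ≢ proj₁ W →
  ∃ λ X → X ∈ₗ S × ∃ λ a → ∃ λ b → Dist U X a × Dist W X b × a ≢ b

MetricDimAtMost : ℕ → ℕ → Set
MetricDimAtMost n m =
  ∃ λ (S : List (Vertex n)) → Unique S × IsResolving S × length S ≤ m

IsSTS : (n : ℕ) → List (Vertex n) → Set
IsSTS n B =
  Unique B ×
  (∀ (i j : Fin n) → i ≢ j →
     ∃ λ X → X ∈ₗ B × i ∈ proj₁ X × j ∈ proj₁ X ×
       (∀ Y → Y ∈ₗ B → i ∈ proj₁ Y → j ∈ proj₁ Y → proj₁ Y ≡ proj₁ X))

module Submission where

-- Distances in K(n,3) are simple once n ≥ 9: d(U,U) = 0, d(U,X) = 1 when U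
-- and X are disjoint, and d(U,X) = 2 when U ≠ X meet, because the at least
-- three points outside U ∪ X form a common neighbour.
-- Given triples U ≠ W, pick a point u lying in exactly one of them, say
-- u ∈ U and u ∉ W.  The three blocks through u and a point of W, together
-- with u, cover at most ten points; for a point v outside them (n ≥ 11) the
-- block X through u and v is disjoint from W.  So d(W,X) = 1 while
-- d(U,X) ∈ {0,2}, and X resolves U and W.
-- For the size bound, the blocks are distinct and two distinct points lie in
-- at most one block, so sending (block, ordered pair of its points) to that
-- ordered pair is injective, giving 6·|S| ≤ n(n-1).

open import Defs
open import Data.Nat using (ℕ; zero; suc; _+_; _*_; _∸_; _≤_; _<_; z≤n; s≤s)
open import Data.Nat.Properties
  using (≡-irrelevant; ≤-trans; ≤-refl; ≤-reflexive; +-mono-≤; +-monoˡ-≤; +-suc; m≤m+n; <-irrefl)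
open import Data.Nat.DivMod using (_/_; _%_; m*n/n≡m; /-monoˡ-≤)
open import Data.Bool using (Bool; true; false) renaming (_≟_ to _≟ᵇ_)
open import Data.Fin using (Fin; punchIn; punchOut; combine; remQuot)
open import Data.Fin.Properties
  using (suc-injective; ¬∀⟶∃¬; injective⇒≤; combine-injective; combine-remQuot;
         punchIn-injective; punchInᵢ≢i; punchOut-injective)
open import Data.Fin.Subset using (Subset; _∈_; _∉_; _∪_; _∩_; ⊥; ∣_∣; ⁅_⁆)
open import Data.Fin.Subset.Properties
  using (_∈?_; ∉⊥; ∣⊥∣≡0; ⊆⊤; ∣⊤∣≡n; ⊆-antisym; x∈⁅x⁆; x∈⁅y⁆⇒x≡y; ∣⁅x⁆∣≡1;
         ∪-identityˡ; x∉⁅y⁆⇒x≢y; ∣p∣≤∣x∷p∣; x∈p∪q⁺; x∈p∪q⁻; x∈p∩q⁺; x∈p∩q⁻; Empty-unique)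
open import Data.Vec using ([]; _∷_; here; there)
open import Data.Vec.Properties using (≡-dec)
open import Data.Product using (∃; _×_; _,_; proj₁; proj₂)
open import Data.Sum using (_⊎_; inj₁; inj₂; [_,_]′)
open import Data.Empty using (⊥-elim)
open import Data.List using (List; _∷_; length; lookup)
open import Data.List.Membership.Propositional using () renaming (_∈_ to _∈ₗ_)
open import Data.List.Membership.Propositional.Properties using (∈-lookup)
open import Data.List.Relation.Unary.Unique.Propositional using (Unique)
open import Data.List.Relation.Unary.AllPairs using (_∷_)
import Data.List.Relation.Unary.All as All
open import Function using (_∘_)
open import Function.Definitions using (Injective)
open import Relation.Binary.PropositionalEquality
  using (_≡_; _≢_; refl; sym; trans; cong; subst; module ≡-Reasoning)
open import Relation.Nullary using (¬_; yes; no)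

private
  variable
    n : ℕ

-- Finite subsets

record Enumeration (p : Subset n) (m : ℕ) : Set where
  field
    elem           : Fin m → Fin n
    elem-injective : Injective _≡_ _≡_ elem
    elem-∈         : ∀ k → elem k ∈ p
    elem-onto      : ∀ {x} → x ∈ p → ∃ λ k → elem k ≡ x

enum-inside : {p : Subset n} {m : ℕ} → Enumeration p m → Enumeration (true ∷ p) (suc m)
enum-inside {p = p} {m} E = record
  { elem = elem′ ; elem-injective = injective ; elem-∈ = elem′-∈ ; elem-onto = onto }
  where
  open Enumeration E
  elem′ : Fin (suc m) → Fin (suc _)
  elem′ Fin.zero    = Fin.zero
  elem′ (Fin.suc k) = Fin.suc (elem k)
  injective : Injective _≡_ _≡_ elem′
  injective {Fin.zero}  {Fin.zero}  _  = refl
  injective {Fin.suc a} {Fin.suc b} eq = cong Fin.suc (elem-injective (suc-injective eq))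
  elem′-∈ : ∀ k → elem′ k ∈ (true ∷ p)
  elem′-∈ Fin.zero    = here
  elem′-∈ (Fin.suc k) = there (elem-∈ k)
  onto : ∀ {x} → x ∈ (true ∷ p) → ∃ λ k → elem′ k ≡ x
  onto here      = Fin.zero , refl
  onto (there x∈p) with k , refl ← elem-onto x∈p = Fin.suc k , refl

enum-outside : {p : Subset n} {m : ℕ} → Enumeration p m → Enumeration (false ∷ p) m
enum-outside {p = p} {m} E = record
  { elem = Fin.suc ∘ elem ; elem-injective = elem-injective ∘ suc-injective
  ; elem-∈ = there ∘ elem-∈ ; elem-onto = onto }
  where
  open Enumeration E
  onto : ∀ {x} → x ∈ (false ∷ p) → ∃ λ k → Fin.suc (elem k) ≡ x
  onto (there x∈p) with k , refl ← elem-onto x∈p = k , refl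

enumerate : (p : Subset n) → Enumeration p ∣ p ∣
enumerate []          = record
  { elem = λ () ; elem-injective = λ { {()} } ; elem-∈ = λ () ; elem-onto = λ () }
enumerate (true ∷ p)  = enum-inside (enumerate p)
enumerate (false ∷ p) = enum-outside (enumerate p)

points : (U : Vertex n) → Enumeration (proj₁ U) 3
points (p , ∣p∣≡3) = subst (Enumeration p) ∣p∣≡3 (enumerate p)

∣p∪q∣≤∣p∣+∣q∣ : (p q : Subset n) → ∣ p ∪ q ∣ ≤ ∣ p ∣ + ∣ q ∣
∣p∪q∣≤∣p∣+∣q∣ []          []       = z≤n
∣p∪q∣≤∣p∣+∣q∣ (true ∷ p)  (b ∷ q)  =
  s≤s (≤-trans (∣p∪q∣≤∣p∣+∣q∣ p q) (+-mono-≤ (≤-refl {∣ p ∣}) (∣p∣≤∣x∷p∣ b q)))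
∣p∪q∣≤∣p∣+∣q∣ (false ∷ p) (true ∷ q)  =
  subst (suc ∣ p ∪ q ∣ ≤_) (sym (+-suc ∣ p ∣ ∣ q ∣)) (s≤s (∣p∪q∣≤∣p∣+∣q∣ p q))
∣p∪q∣≤∣p∣+∣q∣ (false ∷ p) (false ∷ q) = ∣p∪q∣≤∣p∣+∣q∣ p q

card-∪-≤ : (p q : Subset n) {a b : ℕ} → ∣ p ∣ ≤ a → ∣ q ∣ ≤ b → ∣ p ∪ q ∣ ≤ a + b
card-∪-≤ p q p≤a q≤b = ≤-trans (∣p∪q∣≤∣p∣+∣q∣ p q) (+-mono-≤ p≤a q≤b)

∉-∪ˡ : {x : Fin n} {p q : Subset n} → x ∉ p ∪ q → x ∉ p
∉-∪ˡ x∉p∪q x∈p = x∉p∪q (x∈p∪q⁺ (inj₁ x∈p))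

∉-∪ʳ : {x : Fin n} {p q : Subset n} → x ∉ p ∪ q → x ∉ q
∉-∪ʳ x∉p∪q x∈q = x∉p∪q (x∈p∪q⁺ (inj₂ x∈q))

∣⁅x⁆∪p∣≡1+∣p∣ : (x : Fin n) (p : Subset n) → x ∉ p → ∣ ⁅ x ⁆ ∪ p ∣ ≡ suc ∣ p ∣
∣⁅x⁆∪p∣≡1+∣p∣ Fin.zero    (true ∷ p)  x∉p = ⊥-elim (x∉p here)
∣⁅x⁆∪p∣≡1+∣p∣ Fin.zero    (false ∷ p) _   = cong (suc ∘ ∣_∣) (∪-identityˡ p)
∣⁅x⁆∪p∣≡1+∣p∣ (Fin.suc x) (true ∷ p)  x∉p = cong suc (∣⁅x⁆∪p∣≡1+∣p∣ x p (x∉p ∘ there))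
∣⁅x⁆∪p∣≡1+∣p∣ (Fin.suc x) (false ∷ p) x∉p = ∣⁅x⁆∪p∣≡1+∣p∣ x p (x∉p ∘ there)

freshPoint : (p : Subset n) → ∣ p ∣ < n → ∃ λ x → x ∉ p
freshPoint {n} p ∣p∣<n = ¬∀⟶∃¬ n (_∈ p) (_∈? p) (λ full → <-irrefl (∣p∣≡n full) ∣p∣<n)
  where
  ∣p∣≡n : (∀ x → x ∈ p) → ∣ p ∣ ≡ n
  ∣p∣≡n full = trans (cong ∣_∣ (⊆-antisym ⊆⊤ (λ {x} _ → full x))) (∣⊤∣≡n n)

Disjoint : Subset n → Subset n → Set
Disjoint p q = ∀ {x} → x ∈ p → x ∉ q

disjoint⇒∩≡⊥ : {p q : Subset n} → Disjoint p q → p ∩ q ≡ ⊥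
disjoint⇒∩≡⊥ {p = p} {q} p#q =
  Empty-unique λ (x , x∈p∩q) → let (x∈p , x∈q) = x∈p∩q⁻ p q x∈p∩q in p#q x∈p x∈q

adjoinFresh : {x : Fin n} {p t : Subset n} {k : ℕ} → x ∉ p → ∣ t ∣ ≡ k →
              Disjoint t (⁅ x ⁆ ∪ p) → ∃ λ s → ∣ s ∣ ≡ suc k × Disjoint s p
adjoinFresh {x = x} {p} {t} x∉p ∣t∣≡k t#xp =
  ⁅ x ⁆ ∪ t , trans (∣⁅x⁆∪p∣≡1+∣p∣ x t x∉t) (cong suc ∣t∣≡k) , xt#p
  where
  x∉t : x ∉ t
  x∉t x∈t = t#xp x∈t (x∈p∪q⁺ (inj₁ (x∈⁅x⁆ x)))
  xt#p : Disjoint (⁅ x ⁆ ∪ t) p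
  xt#p y∈ with x∈p∪q⁻ ⁅ x ⁆ t y∈
  ... | inj₁ y∈⁅x⁆ rewrite x∈⁅y⁆⇒x≡y x y∈⁅x⁆ = x∉p
  ... | inj₂ y∈t = λ y∈p → t#xp y∈t (x∈p∪q⁺ (inj₂ y∈p))

freshSet : (k : ℕ) (p : Subset n) → ∣ p ∣ + k ≤ n → ∃ λ t → ∣ t ∣ ≡ k × Disjoint t p
freshSet {n} zero p _ = ⊥ , ∣⊥∣≡0 n , λ x∈⊥ → ⊥-elim (∉⊥ x∈⊥)
freshSet {n} (suc k) p room rewrite +-suc ∣ p ∣ k
  with x , x∉p ← freshPoint p (≤-trans (s≤s (m≤m+n ∣ p ∣ k)) room)
  with t , ∣t∣≡k , t#xp ← freshSet k (⁅ x ⁆ ∪ p)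
         (subst (λ c → c + k ≤ n) (sym (∣⁅x⁆∪p∣≡1+∣p∣ x p x∉p)) room)
  = adjoinFresh x∉p ∣t∣≡k t#xp

Distinguishes : Fin n → Subset n → Subset n → Set
Distinguishes x p q = (x ∈ p × x ∉ q) ⊎ (x ∈ q × x ∉ p)

distinguishes-∷ : {p q : Subset n} (b : Bool) → (∃ λ x → Distinguishes x p q) →
                  ∃ λ x → Distinguishes x (b ∷ p) (b ∷ q)
distinguishes-∷ _ (x , inj₁ (x∈p , x∉q)) = Fin.suc x , inj₁ (there x∈p , λ { (there x∈q) → x∉q x∈q })
distinguishes-∷ _ (x , inj₂ (x∈q , x∉p)) = Fin.suc x , inj₂ (there x∈q , λ { (there x∈p) → x∉p x∈p })

distinguishingPoint : (p q : Subset n) → p ≢ q → ∃ λ x → Distinguishes x p q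
distinguishingPoint []          []          p≢q = ⊥-elim (p≢q refl)
distinguishingPoint (true ∷ p)  (false ∷ q) _   = Fin.zero , inj₁ (here , λ ())
distinguishingPoint (false ∷ p) (true ∷ q)  _   = Fin.zero , inj₂ (here , λ ())
distinguishingPoint (true ∷ p)  (true ∷ q)  p≢q =
  distinguishes-∷ true (distinguishingPoint p q (p≢q ∘ cong (true ∷_)))
distinguishingPoint (false ∷ p) (false ∷ q) p≢q =
  distinguishes-∷ false (distinguishingPoint p q (p≢q ∘ cong (false ∷_)))

-- Distances in K(n,3)

vertex-≡ : (U X : Vertex n) → proj₁ U ≡ proj₁ X → U ≡ X
vertex-≡ (p , e₁) (.p , e₂) refl = cong (p ,_) (≡-irrelevant e₁ e₂)

meeting⇒¬Adj : {U X : Vertex n} {x : Fin n} → x ∈ proj₁ U → x ∈ proj₁ X → ¬ Adj U X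
meeting⇒¬Adj x∈U x∈X U∩X≡⊥ = ∉⊥ (subst (_ ∈_) U∩X≡⊥ (x∈p∩q⁺ (x∈U , x∈X)))

-- For n ≥ 9 any two triples have a common neighbour: three points outside
-- their union (which has at most six points).
commonNeighbour : 9 ≤ n → (U X : Vertex n) → ∃ λ Z → Adj U Z × Adj Z X
commonNeighbour {n} 9≤n (u , ∣u∣≡3) (x , ∣x∣≡3) =
  let (z , ∣z∣≡3 , z#ux) = freshSet 3 (u ∪ x) room
  in (z , ∣z∣≡3) , disjoint⇒∩≡⊥ (λ y∈u y∈z → z#ux y∈z (x∈p∪q⁺ (inj₁ y∈u)))
                 , disjoint⇒∩≡⊥ (λ y∈z y∈x → z#ux y∈z (x∈p∪q⁺ (inj₂ y∈x)))
  where
  room : ∣ u ∪ x ∣ + 3 ≤ n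
  room = ≤-trans (+-monoˡ-≤ 3 (card-∪-≤ u x (≤-reflexive ∣u∣≡3) (≤-reflexive ∣x∣≡3))) 9≤n

dist-self : (U : Vertex n) → Dist U U 0
dist-self U = here , λ _ _ → z≤n

dist-adjacent : {W X : Vertex n} → Adj W X → proj₁ W ≢ proj₁ X → Dist W X 1
dist-adjacent {W = W} {X} adj W≢X = step adj here , shortest
  where
  shortest : ∀ m → Walk W X m → 1 ≤ m
  shortest zero    here = ⊥-elim (W≢X refl)
  shortest (suc m) _    = s≤s z≤n

dist-meeting : 9 ≤ n → {U X : Vertex n} {x : Fin n} → proj₁ U ≢ proj₁ X →
               x ∈ proj₁ U → x ∈ proj₁ X → Dist U X 2
dist-meeting 9≤n {U} {X} U≢X x∈U x∈X
  with Z , U~Z , Z~X ← commonNeighbour 9≤n U X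
  = step {V = Z} U~Z (step Z~X here) , shortest
  where
  shortest : ∀ m → Walk U X m → 2 ≤ m
  shortest zero          here             = ⊥-elim (U≢X refl)
  shortest (suc zero)    (step U~X here)  = ⊥-elim (meeting⇒¬Adj {U = U} {X} x∈U x∈X U~X)
  shortest (suc (suc m)) _                = s≤s (s≤s z≤n)

dist-meeting-0or2 : 9 ≤ n → (U X : Vertex n) {x : Fin n} → x ∈ proj₁ U → x ∈ proj₁ X →
                    Dist U X 0 ⊎ Dist U X 2
dist-meeting-0or2 9≤n U X x∈U x∈X with ≡-dec _≟ᵇ_ (proj₁ U) (proj₁ X)
... | yes U≡X = inj₁ (subst (λ V → Dist V X 0) (sym (vertex-≡ U X U≡X)) (dist-self X))
... | no U≢X  = inj₂ (dist-meeting 9≤n U≢X x∈U x∈X)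

-- Blocks of a Steiner triple system resolve K(n,3)

module BlockThrough {B : List (Vertex n)} (sts : IsSTS n B) (i j : Fin n) (i≢j : i ≢ j) where
  block : Vertex n
  block = proj₁ (proj₂ sts i j i≢j)

  block-∈ : block ∈ₗ B
  block-∈ = proj₁ (proj₂ (proj₂ sts i j i≢j))

  first∈block : i ∈ proj₁ block
  first∈block = proj₁ (proj₂ (proj₂ (proj₂ sts i j i≢j)))

  second∈block : j ∈ proj₁ block
  second∈block = proj₁ (proj₂ (proj₂ (proj₂ (proj₂ sts i j i≢j))))

  block-unique : ∀ {Y} → Y ∈ₗ B → i ∈ proj₁ Y → j ∈ proj₁ Y → proj₁ Y ≡ proj₁ block
  block-unique {Y} = proj₂ (proj₂ (proj₂ (proj₂ (proj₂ sts i j i≢j)))) Y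

-- In a Steiner triple system of order n ≥ 11, a point u outside a triple W
-- lies in a block disjoint from W: the block through u and any point v
-- avoiding u and the three blocks joining u to the points of W.
separatingBlock : 11 ≤ n → {B : List (Vertex n)} → IsSTS n B →
                  (W : Vertex n) {u : Fin n} → u ∉ proj₁ W →
                  ∃ λ X → X ∈ₗ B × u ∈ proj₁ X × Adj W X
separatingBlock {n} 11≤n {B} sts W {u} u∉W =
  X.block , X.block-∈ , X.first∈block , disjoint⇒∩≡⊥ W#X
  where
  open Enumeration (points W) renaming (elem to w; elem-∈ to w∈W; elem-onto to w-onto)

  u≢w : ∀ k → u ≢ w k
  u≢w k u≡w = u∉W (subst (_∈ proj₁ W) (sym u≡w) (w∈W k))

  module Y (k : Fin 3) = BlockThrough sts u (w k) (u≢w k)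
  Y : Fin 3 → Subset n
  Y k = proj₁ (Y.block k)

  k₀ k₁ k₂ : Fin 3
  k₀ = Fin.zero
  k₁ = Fin.suc Fin.zero
  k₂ = Fin.suc (Fin.suc Fin.zero)

  covered : Subset n
  covered = Y k₀ ∪ (Y k₁ ∪ (Y k₂ ∪ ⁅ u ⁆))

  ∣covered∣≤10 : ∣ covered ∣ ≤ 10
  ∣covered∣≤10 =
    card-∪-≤ (Y k₀) _ (≤-reflexive (∣Y∣≡3 k₀))
      (card-∪-≤ (Y k₁) _ (≤-reflexive (∣Y∣≡3 k₁))
        (card-∪-≤ (Y k₂) ⁅ u ⁆ (≤-reflexive (∣Y∣≡3 k₂)) (≤-reflexive (∣⁅x⁆∣≡1 u))))
    where
    ∣Y∣≡3 : ∀ k → ∣ Y k ∣ ≡ 3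
    ∣Y∣≡3 k = proj₂ (Y.block k)

  fresh : ∃ λ v → v ∉ covered
  fresh = freshPoint covered (≤-trans (s≤s ∣covered∣≤10) 11≤n)

  v : Fin n
  v = proj₁ fresh

  v∉covered : v ∉ covered
  v∉covered = proj₂ fresh

  v∉Y : ∀ k → v ∉ Y k
  v∉Y Fin.zero                     = ∉-∪ˡ v∉covered
  v∉Y (Fin.suc Fin.zero)           = ∉-∪ˡ (∉-∪ʳ v∉covered)
  v∉Y (Fin.suc (Fin.suc Fin.zero)) = ∉-∪ˡ (∉-∪ʳ (∉-∪ʳ v∉covered))

  u≢v : u ≢ v
  u≢v = x∉⁅y⁆⇒x≢y (∉-∪ʳ (∉-∪ʳ (∉-∪ʳ v∉covered))) ∘ sym

  module X = BlockThrough sts u v u≢v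

  -- A point of W in X would make X the block Y k, which misses v.
  W#X : Disjoint (proj₁ W) (proj₁ X.block)
  W#X y∈W y∈X with k , refl ← w-onto y∈W =
    v∉Y k (subst (v ∈_) (Y.block-unique k X.block-∈ X.first∈block y∈X) X.second∈block)

Resolves : Vertex n → Vertex n → Vertex n → Set
Resolves X U W = ∃ λ a → ∃ λ b → Dist U X a × Dist W X b × a ≢ b

resolves-sym : {X U W : Vertex n} → Resolves X U W → Resolves X W U
resolves-sym (a , b , dU , dW , a≢b) = b , a , dW , dU , a≢b ∘ sym

-- A triple X disjoint from W and containing a point u ∈ U resolves U and W
-- (n ≥ 9): d(W,X) = 1, while d(U,X) is 0 or 2.
resolvedBy : 9 ≤ n → {U W X : Vertex n} {u : Fin n} → u ∈ proj₁ U → u ∉ proj₁ W →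
             u ∈ proj₁ X → Adj W X → Resolves X U W
resolvedBy 9≤n {U} {W} {X} {u} u∈U u∉W u∈X W~X =
  [ (λ d₀ → 0 , 1 , d₀ , dW , λ ()) , (λ d₂ → 2 , 1 , d₂ , dW , λ ()) ]′
  (dist-meeting-0or2 9≤n U X u∈U u∈X)
  where
  dW : Dist W X 1
  dW = dist-adjacent W~X (λ W≡X → u∉W (subst (u ∈_) (sym W≡X) u∈X))

separatingResolver : 11 ≤ n → {B : List (Vertex n)} → IsSTS n B → {U W : Vertex n} {u : Fin n} →
                     u ∈ proj₁ U → u ∉ proj₁ W → ∃ λ X → X ∈ₗ B × Resolves X U W
separatingResolver 11≤n sts {W = W} u∈U u∉W =
  let (X , X∈B , u∈X , W~X) = separatingBlock 11≤n sts W u∉W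
  in X , X∈B , resolvedBy (≤-trans (m≤m+n 9 2) 11≤n) u∈U u∉W u∈X W~X

resolving : 11 ≤ n → (B : List (Vertex n)) → IsSTS n B → IsResolving B
resolving 11≤n B sts U W U≢W with distinguishingPoint (proj₁ U) (proj₁ W) U≢W
... | _ , inj₁ (u∈U , u∉W) = separatingResolver 11≤n sts u∈U u∉W
... | _ , inj₂ (u∈W , u∉U) =
  let (X , X∈B , resolvesWU) = separatingResolver 11≤n sts u∈W u∉U
  in X , X∈B , resolves-sym resolvesWU

-- Size of a Steiner triple system

lookup-injective : {A : Set} {xs : List A} → Unique xs → ∀ {i j} → lookup xs i ≡ lookup xs j → i ≡ j
lookup-injective {xs = _ ∷ _}  (_ ∷ _)    {Fin.zero}  {Fin.zero}  _  = refl
lookup-injective {xs = _ ∷ xs} (x∉ ∷ _)   {Fin.zero}  {Fin.suc j} eq = ⊥-elim (All.lookup x∉ (∈-lookup {xs = xs} j) eq)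
lookup-injective {xs = _ ∷ xs} (x∉ ∷ _)   {Fin.suc i} {Fin.zero}  eq = ⊥-elim (All.lookup x∉ (∈-lookup {xs = xs} i) (sym eq))
lookup-injective {xs = _ ∷ _}  (_ ∷ uniq) {Fin.suc i} {Fin.suc j} eq = cong Fin.suc (lookup-injective uniq eq)

IsPacking : (n : ℕ) → List (Vertex n) → Set
IsPacking n B = Unique B × (∀ {X Y} → X ∈ₗ B → Y ∈ₗ B → ∀ {i j} → i ≢ j →
                  i ∈ proj₁ X → j ∈ proj₁ X → i ∈ proj₁ Y → j ∈ proj₁ Y → X ≡ Y)

-- Both blocks through i and j equal the block of the system through them.
sts⇒packing : {B : List (Vertex n)} → IsSTS n B → IsPacking n B
sts⇒packing sts@(unique , _) = unique , λ {X} {Y} X∈B Y∈B {i} {j} i≢j i∈X j∈X i∈Y j∈Y →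
  let open BlockThrough sts i j i≢j
  in vertex-≡ X Y (trans (block-unique X∈B i∈X j∈X) (sym (block-unique Y∈B i∈Y j∈Y)))

pairCode : (i j : Fin (suc n)) → i ≢ j → Fin (suc n * n)
pairCode i j i≢j = combine i (punchOut i≢j)

pairCode-injective : {i j i′ j′ : Fin (suc n)} (i≢j : i ≢ j) (i′≢j′ : i′ ≢ j′) →
                     pairCode i j i≢j ≡ pairCode i′ j′ i′≢j′ → i ≡ i′ × j ≡ j′
pairCode-injective {i = i} {i′ = i′} i≢j i′≢j′ eq
  with combine-injective i (punchOut i≢j) i′ (punchOut i′≢j′) eq
... | refl , punched = refl , punchOut-injective i≢j i′≢j′ punched

flag : {m : ℕ} → Fin (m * 6) → Fin m × Fin 3 × Fin 2
flag {m} x = let (k , r) = remQuot {m} 6 x in k , remQuot {3} 2 r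

flag-injective : {m : ℕ} → Injective _≡_ _≡_ (flag {m})
flag-injective {m} {x} {y} eq = begin
  x                  ≡⟨ unflag-flag x ⟨
  unflag (flag x)    ≡⟨ cong unflag eq ⟩
  unflag (flag y)    ≡⟨ unflag-flag y ⟩
  y                  ∎
  where
  open ≡-Reasoning
  unflag : Fin m × Fin 3 × Fin 2 → Fin (m * 6)
  unflag (k , p , q) = combine k (combine p q)
  unflag-flag : ∀ z → unflag (flag z) ≡ z
  unflag-flag z = let (k , r) = remQuot {m} 6 z in
    trans (cong (combine {m} k) (combine-remQuot {3} 2 r)) (combine-remQuot {m} 6 z)

-- A packing on n points has at most n(n-1)/6 blocks: each block carries six
-- ordered pairs of distinct points, and no ordered pair lies in two blocks.
packing-size : (B : List (Vertex (suc n))) → IsPacking (suc n) B → length B * 6 ≤ suc n * n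
packing-size {n} B (unique , sameBlock) = injective⇒≤ {f = flagPair} flagPair-injective
  where
  open module Pts (k : Fin (length B)) = Enumeration (points (lookup B k))

  distinct : ∀ k p q → elem k p ≢ elem k (punchIn p q)
  distinct k p q eq = punchInᵢ≢i p q (sym (elem-injective k eq))

  -- The (p, q)-th ordered pair of block k: its p-th point, then one of the
  -- other two chosen by q.
  pairOf : Fin (length B) → Fin 3 → Fin 2 → Fin (suc n * n)
  pairOf k p q = pairCode (elem k p) (elem k (punchIn p q)) (distinct k p q)

  pairOf-injective : ∀ {k p q k′ p′ q′} → pairOf k p q ≡ pairOf k′ p′ q′ → (k , p , q) ≡ (k′ , p′ , q′)
  pairOf-injective {k} {p} {q} {k′} {p′} {q′} eq
    with first≡ , second≡ ← pairCode-injective (distinct k p q) (distinct k′ p′ q′) eq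
    with refl ← lookup-injective unique
                  (sameBlock (∈-lookup k) (∈-lookup k′) (distinct k p q)
                    (elem-∈ k p) (elem-∈ k (punchIn p q))
                    (subst (_∈ _) (sym first≡) (elem-∈ k′ p′))
                    (subst (_∈ _) (sym second≡) (elem-∈ k′ (punchIn p′ q′))))
    with refl ← elem-injective k first≡
    with refl ← punchIn-injective p q q′ (elem-injective k second≡)
    = refl

  -- A block reads off from either of its pairs, so flags map injectively to pairs.
  flagPair : Fin (length B * 6) → Fin (suc n * n)
  flagPair x = let (k , p , q) = flag x in pairOf k p q

  flagPair-injective : Injective _≡_ _≡_ flagPair
  flagPair-injective {x} {y} eq = flag-injective (pairOf-injective eq)

-- The hypothesis n ≡ 1, 3 (mod 6) is the existence condition for Steiner
-- triple systems; the argument itself only uses n ≥ 13.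
corollary4p6 : (n : ℕ) → (n % 6 ≡ 1 ⊎ n % 6 ≡ 3) → 13 ≤ n →
    (B : List (Vertex n)) → IsSTS n B →
    IsResolving B × MetricDimAtMost n ((n * (n ∸ 1)) / 6)
corollary4p6 (suc n) _ 13≤n B sts =
  blocksResolve , B , proj₁ sts , blocksResolve , fewBlocks
  where
  blocksResolve : IsResolving B
  blocksResolve = resolving (≤-trans (m≤m+n 11 2) 13≤n) B sts

  fewBlocks : length B ≤ (suc n * n) / 6
  fewBlocks = subst (_≤ (suc n * n) / 6) (m*n/n≡m (length B) 6)
                (/-monoˡ-≤ 6 (packing-size B (sts⇒packing sts)))
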